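{- Let $G$ be a maximal nontraceable graph and let $v\in V(G)$ with $d(v)=2$. Then the two neighbours of $v$ are adjacent. If in addition $G$ is $2$-connected, then each neighbour of $v$ has degree at least $4$.
   Context: All graphs are simple and finite. A graph is traceable if it has a hamiltonian path (a path containing all its vertices). A graph $G$ is maximal nontraceable (MNT) if $G$ is not traceable but $G+e$ is traceable for every edge $e$ of the complement $\overline{G}$. $d(v)$ denotes the degree of $v$. -}

module Defs where

open import Data.Nat using (ℕ; _≥_; _≤_)
open import Data.Bool using (Bool; true; false; _∨_)
open import Data.Fin using (Fin; _≟_)
open import Data.Fin.Properties using () 
open import Data.List using (List; []; _∷_; length; filter; allFin; last)
open import Data.List.Membership.Propositional using (_∈_; _∉_)
open import Data.List.Relation.Unary.Unique.Propositional using (Unique)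
open import Data.List.Relation.Unary.All using (All)
open import Data.Maybe using (just)
open import Data.Product using (Σ; _×_; ∃; ∃-syntax)
open import Relation.Nullary using (¬_; does)
open import Relation.Binary.PropositionalEquality using (_≡_; _≢_)

record Graph (n : ℕ) : Set where
  field
    adj   : Fin n → Fin n → Bool
    sym   : ∀ u v → adj u v ≡ adj v u
    irrefl : ∀ v → adj v v ≡ false
open Graph public

_~[_]_ : ∀ {n} → Fin n → Graph n → Fin n → Set
u ~[ G ] v = adj G u v ≡ true

data IsWalk {n} (G : Graph n) : List (Fin n) → Set where
  walk-[]  : IsWalk G []
  walk-[x] : ∀ x → IsWalk G (x ∷ [])
  walk-∷   : ∀ x y xs → x ~[ G ] y → IsWalk G (y ∷ xs) → IsWalk G (x ∷ y ∷ xs)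

record HamPath {n} (G : Graph n) (p : List (Fin n)) : Set where
  field
    isWalk : IsWalk G p
    unique : Unique p
    covers : ∀ v → v ∈ p
open HamPath public

Traceable : ∀ {n} → Graph n → Set
Traceable G = ∃[ p ] HamPath G p

addEdge : ∀ {n} → Graph n → Fin n → Fin n → Graph n
addEdge {n} G u v = record { adj = a ; sym = s ; irrefl = i }
  where
  open import Data.Bool using (_∧_; not)
  open import Data.Bool.Properties using (∨-comm; ∧-comm)
  open import Relation.Binary.PropositionalEquality using (refl; cong₂; trans)
  new : Fin n → Fin n → Bool
  new x y = (does (x ≟ u) ∧ does (y ≟ v)) ∨ (does (x ≟ v) ∧ does (y ≟ u))
  a : Fin n → Fin n → Bool
  a x y = not (does (x ≟ y)) ∧ (adj G x y ∨ new x y)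
  neq : ∀ x y → does (x ≟ y) ≡ does (y ≟ x)
  neq x y with x ≟ y | y ≟ x
  ... | Relation.Nullary.yes _ | Relation.Nullary.yes _ = refl
  ... | Relation.Nullary.no _  | Relation.Nullary.no _  = refl
  ... | Relation.Nullary.yes p | Relation.Nullary.no q  = Data.Empty.⊥-elim (q (Relation.Binary.PropositionalEquality.sym p))
    where import Data.Empty
  ... | Relation.Nullary.no q  | Relation.Nullary.yes p = Data.Empty.⊥-elim (q (Relation.Binary.PropositionalEquality.sym p))
    where import Data.Empty
  s : ∀ x y → a x y ≡ a y x
  s x y = cong₂ (λ b c → not b ∧ c) (neq x y)
            (cong₂ _∨_ (Graph.sym G x y)
              (trans (∨-comm (does (x ≟ u) ∧ does (y ≟ v)) _)
                (cong₂ _∨_ (∧-comm (does (x ≟ v)) _) (∧-comm (does (x ≟ u)) _))))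
  i : ∀ x → a x x ≡ false
  i x with x ≟ x
  ... | Relation.Nullary.yes _ = refl
  ... | Relation.Nullary.no q = Data.Empty.⊥-elim (q refl)
    where import Data.Empty

MaximalNontraceable : ∀ {n} → Graph n → Set
MaximalNontraceable {n} G =
  ¬ Traceable G × (∀ (u v : Fin n) → u ≢ v → adj G u v ≡ false → Traceable (addEdge G u v))

degree : ∀ {n} → Graph n → Fin n → ℕ
degree G v = length (filter (λ w → Data.Bool._≟_ (adj G v w) true) (allFin _))
  where import Data.Bool

record PathAvoiding {n} (G : Graph n) (S : List (Fin n)) (x y : Fin n) : Set where
  field
    verts  : List (Fin n)
    isWalk : IsWalk G (x ∷ verts)
    ends   : last (x ∷ verts) ≡ just y
    avoid  : All (_∉ S) (x ∷ verts)
open PathAvoiding public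

Connected : ∀ {n} → Graph n → Set
Connected {n} G = ∀ (x y : Fin n) → PathAvoiding G [] x y

TwoConnected : ∀ {n} → Graph n → Set
TwoConnected {n} G =
  n ≥ 3 × Connected G ×
  (∀ (w x y : Fin n) → x ≢ w → y ≢ w → PathAvoiding G (w ∷ []) x y)

module Submission where

-- Let N(v) = {a, b}. If ab were not an edge, G + ab would have a hamiltonian path, necessarily
-- through ab. As the only neighbours of v in G + ab are a and b, up to reversal the path ends in
-- a b v or b a v, and moving v between a and b gives a hamiltonian path of G.
--
-- For the degree bound, suppose d(a) ≤ 3. If N(a) = {v, b}, then b separates {v, a} from all
-- other vertices, so by 2-connectedness G consists of v, a, b only and v a b is a hamiltonian path.
-- Otherwise N(a) = {v, b, c}, and in H = G + vc the vertices v and a are twins: apart from each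
-- other both have the neighbours b and c. The transposition of v and a is an automorphism of H
-- sending the new edge vc to the old edge ac. Hence a hamiltonian path of H yields one of G
-- (itself or its transpose) unless it uses both vc and ac, i.e. contains v c a. If b comes before
-- that segment, a is the last vertex and … v c a can be rerouted as … v a c in G; if b comes
-- after it, v is the first vertex and v c a b … can be rerouted as c a v b … in G.

open import Defs hiding (sym)
open import Data.Nat using (ℕ; _≤_; _≥_; s≤s; z≤n; _≤?_)
open import Data.Nat.Properties using (≤-trans; ≤-reflexive; ≤-pred; <-irrefl; ≰⇒>)
import Data.Bool as Bool
open import Data.Bool using (true; false)
open import Data.Bool.Properties using (∨-zeroʳ; ¬-not)
open import Data.Fin using (Fin; _≟_)
open import Data.Fin.Properties using (any?)
open import Data.Fin.Permutation.Components using (transpose; transpose-inverse)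
open import Data.Maybe using (just)
open import Data.List using (List; []; _∷_; _++_; _ʳ++_; [_]; _∷ʳ_; last; reverse; map; length; filter; allFin)
open import Data.List.Properties using (++-assoc; length-++-sucʳ; ++-ʳ++; ʳ++-defn; map-++; map-∘; map-cong; map-id; ∷-injective; ∷ʳ-injectiveʳ)
open import Data.List.Membership.Propositional using (_∈_; _∉_)
open import Data.List.Membership.Propositional.Properties using (∈-++⁺ˡ; ∈-++⁺ʳ; ∈-++⁻; ∈-∃++; ∈-map⁺; ∈-filter⁺; ∈-allFin)
import Data.List.Membership.DecPropositional as DecMembership
open import Data.List.Relation.Unary.Any using (here; there)
open import Data.List.Relation.Unary.All as All using (All; []; _∷_)
open import Data.List.Relation.Unary.All.Properties using (¬Any⇒All¬)
open import Data.List.Relation.Unary.AllPairs using ([]; _∷_)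
open import Data.List.Relation.Unary.Unique.Propositional using (Unique)
open import Data.List.Relation.Unary.Unique.Propositional.Properties using (Unique[x∷xs]⇒x∉xs; map⁺)
open import Data.List.Relation.Binary.Subset.Propositional using (_⊆_)
open import Data.List.Relation.Binary.Permutation.Propositional using (_↭_; prep; swap; ↭-refl; ↭-sym; ↭⇒↭ₛ)
open import Data.List.Relation.Binary.Permutation.Propositional.Properties using (∈-resp-↭; ↭-reverse; ++⁺ˡ; shift)
import Data.List.Relation.Binary.Permutation.Setoid.Properties as PermutationProperties
open import Data.Product using (_×_; _,_; proj₁; proj₂; ∃; ∃₂)
open import Data.Sum as Sum using (_⊎_; inj₁; inj₂)
open import Data.Empty using (⊥-elim)
open import Function using (_∘_; case_of_)
open import Relation.Nullary using (¬?; yes; no; _×-dec_)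
open import Relation.Nullary.Decidable using (dec-true; decidable-stable)
open import Relation.Binary.Definitions using (DecidableEquality)
open import Relation.Binary.PropositionalEquality using (_≡_; _≢_; refl; sym; trans; cong; subst; subst₂; module ≡-Reasoning) renaming (setoid to ≡-setoid)

private variable
  n : ℕ

-- Lists without repetition

module _ {A : Set} where

  ∈-swap : ∀ {x y z : A} {zs} → z ∈ x ∷ y ∷ zs → z ∈ y ∷ x ∷ zs
  ∈-swap (here z≡x)          = there (here z≡x)
  ∈-swap (there (here z≡y))  = here z≡y
  ∈-swap (there (there z∈zs)) = there (there z∈zs)

  unique-++-disjoint : ∀ xs {ys : List A} {x} → Unique (xs ++ ys) → x ∈ xs → x ∉ ys
  unique-++-disjoint (_ ∷ xs) (x∉xs ∷ _) (here refl)  x∈ys = All.lookup x∉xs (∈-++⁺ʳ xs x∈ys) refl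
  unique-++-disjoint (_ ∷ xs) (_ ∷ u)    (there x∈xs) = unique-++-disjoint xs u x∈xs

  unique-∉-∷ʳ : ∀ xs {x y : A} {ys} → Unique (xs ++ x ∷ y ∷ ys) → y ∉ xs ∷ʳ x
  unique-∉-∷ʳ xs {x} u y∈ =
    unique-++-disjoint (xs ∷ʳ x) (subst Unique (sym (++-assoc xs [ x ] _)) u) y∈ (here refl)

  unique-split : ∀ xs xs′ {x : A} {ys ys′} → Unique (xs ++ x ∷ ys) →
                 xs ++ x ∷ ys ≡ xs′ ++ x ∷ ys′ → xs ≡ xs′ × ys ≡ ys′
  unique-split []       []        _       refl = refl , refl
  unique-split []       (_ ∷ xs′) u       refl = ⊥-elim (Unique[x∷xs]⇒x∉xs u (∈-++⁺ʳ xs′ (here refl)))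
  unique-split (_ ∷ xs) []        u       refl = ⊥-elim (unique-++-disjoint (_ ∷ xs) u (here refl) (here refl))
  unique-split (_ ∷ xs) (_ ∷ xs′) (_ ∷ u) eq with ∷-injective eq
  ... | refl , eq′ with unique-split xs xs′ u eq′
  ...   | refl , refl = refl , refl

  ⊆⇒length≤ : ∀ {xs ys : List A} → Unique xs → xs ⊆ ys → length xs ≤ length ys
  ⊆⇒length≤ {[]}     _           _     = z≤n
  ⊆⇒length≤ {x ∷ xs} (x∉xs ∷ u) xs⊆ys with ∈-∃++ (xs⊆ys (here refl))
  ... | ys₁ , ys₂ , refl =
    subst (_ ≤_) (sym (length-++-sucʳ ys₁ x ys₂)) (s≤s (⊆⇒length≤ u xs⊆ys₁ys₂))
    where
    xs⊆ys₁ys₂ : xs ⊆ ys₁ ++ ys₂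
    xs⊆ys₁ys₂ z∈xs with ∈-++⁻ ys₁ (xs⊆ys (there z∈xs))
    ... | inj₁ z∈ys₁         = ∈-++⁺ˡ z∈ys₁
    ... | inj₂ (here refl)   = ⊥-elim (All.lookup x∉xs z∈xs refl)
    ... | inj₂ (there z∈ys₂) = ∈-++⁺ʳ ys₁ z∈ys₂

  ⊆∧length≤⇒⊇ : DecidableEquality A → ∀ {xs ys : List A} →
                Unique xs → xs ⊆ ys → length ys ≤ length xs → ys ⊆ xs
  ⊆∧length≤⇒⊇ _≟_ {xs} {ys} u xs⊆ys ys≤xs {y} y∈ys with DecMembership._∈?_ _≟_ y xs
  ... | yes y∈xs = y∈xs
  ... | no  y∉xs =
    ⊥-elim (<-irrefl refl (≤-trans (⊆⇒length≤ (¬Any⇒All¬ xs y∉xs ∷ u) y∷xs⊆ys) ys≤xs))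
    where
    y∷xs⊆ys : y ∷ xs ⊆ ys
    y∷xs⊆ys (here refl)  = y∈ys
    y∷xs⊆ys (there z∈xs) = xs⊆ys z∈xs

  Traverses : List A → A → A → Set
  Traverses xs x y = ∃₂ λ ys zs → xs ≡ ys ++ x ∷ y ∷ zs

  reverse-middle : ∀ xs (x y : A) ys → reverse (xs ++ x ∷ y ∷ ys) ≡ reverse ys ++ y ∷ x ∷ reverse xs
  reverse-middle xs x y ys = begin
    reverse (xs ++ x ∷ y ∷ ys)       ≡⟨ ++-ʳ++ xs ⟩
    ys ʳ++ y ∷ x ∷ reverse xs       ≡⟨ ʳ++-defn ys ⟩
    reverse ys ++ y ∷ x ∷ reverse xs ∎
    where open ≡-Reasoning

  traverses-reverse : ∀ {xs} {x y : A} → Traverses xs x y → Traverses (reverse xs) y x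
  traverses-reverse {x = x} {y} (ys , zs , refl) = reverse zs , reverse ys , reverse-middle ys x y zs

  traverses-next : ∀ xs {x y z : A} {ys} → Unique (xs ++ x ∷ y ∷ ys) → x ≢ z →
                   Traverses (xs ++ x ∷ y ∷ ys) z y ⊎ Traverses (xs ++ x ∷ y ∷ ys) y z →
                   ∃ λ ys′ → ys ≡ z ∷ ys′
  traverses-next xs {x} {y} {z} {ys} u x≢z (inj₁ (xs′ , ys′ , eq)) =
    ⊥-elim (x≢z (∷ʳ-injectiveʳ xs xs′ (proj₁ (unique-split (xs ∷ʳ x) (xs′ ∷ʳ z) u′ eq′))))
    where
    u′ : Unique ((xs ∷ʳ x) ++ y ∷ ys)
    u′ = subst Unique (sym (++-assoc xs [ x ] _)) u
    eq′ : (xs ∷ʳ x) ++ y ∷ ys ≡ (xs′ ∷ʳ z) ++ y ∷ ys′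
    eq′ = trans (++-assoc xs [ x ] _) (trans eq (sym (++-assoc xs′ [ z ] _)))
  traverses-next xs {x} u _ (inj₂ (xs′ , ys′ , eq)) =
    ys′ , proj₂ (unique-split (xs ∷ʳ x) xs′ (subst Unique (sym (++-assoc xs [ x ] _)) u)
                   (trans (++-assoc xs [ x ] _) eq))

traverses-map : ∀ {A B : Set} (f : A → B) {xs} {x y : A} →
                Traverses xs x y → Traverses (map f xs) (f x) (f y)
traverses-map f {x = x} {y} (ys , zs , refl) = map f ys , map f zs , map-++ f ys (x ∷ y ∷ zs)

traverses-map⁻ : ∀ {A B : Set} {f : A → B} {g : B → A} → (∀ x → g (f x) ≡ x) →
                 ∀ {xs} {x y : B} → Traverses (map f xs) x y → Traverses xs (g x) (g y)
traverses-map⁻ {f = f} {g} g∘f≗id {xs} t with traverses-map g t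
... | ys , zs , eq = ys , zs , trans (sym map-g∘f≡id) eq
  where
  map-g∘f≡id : map g (map f xs) ≡ xs
  map-g∘f≡id = trans (sym (map-∘ xs)) (trans (map-cong g∘f≗id xs) (map-id xs))

-- Walks and hamiltonian paths

~-sym : ∀ (G : Graph n) {x y} → x ~[ G ] y → y ~[ G ] x
~-sym G {x} {y} x~y = trans (Graph.sym G y x) x~y

~-irrefl : ∀ (G : Graph n) {x y} → x ~[ G ] y → x ≢ y
~-irrefl G {x} x~x refl with () ← trans (sym x~x) (irrefl G x)

infix 4 N[_]_⊆_

N[_]_⊆_ : Graph n → Fin n → List (Fin n) → Set
N[ G ] v ⊆ S = ∀ {z} → v ~[ G ] z → z ∈ S

module _ {G : Graph n} where

  walk-∷⁻ : ∀ {x xs} → IsWalk G (x ∷ xs) → IsWalk G xs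
  walk-∷⁻ (walk-[x] _)        = walk-[]
  walk-∷⁻ (walk-∷ _ _ _ _ wk) = wk

  walk-++⁻ʳ : ∀ xs {ys} → IsWalk G (xs ++ ys) → IsWalk G ys
  walk-++⁻ʳ []       wk = wk
  walk-++⁻ʳ (_ ∷ xs) wk = walk-++⁻ʳ xs (walk-∷⁻ wk)

  walk-edge : ∀ xs {x y ys} → IsWalk G (xs ++ x ∷ y ∷ ys) → x ~[ G ] y
  walk-edge xs wk with walk-++⁻ʳ xs wk
  ... | walk-∷ _ _ _ x~y _ = x~y

  walk-prefix : ∀ xs {x ys} → IsWalk G (xs ++ x ∷ ys) → IsWalk G (xs ∷ʳ x)
  walk-prefix []           _                    = walk-[x] _
  walk-prefix (_ ∷ [])     (walk-∷ _ _ _ e _)  = walk-∷ _ _ _ e (walk-[x] _)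
  walk-prefix (_ ∷ y ∷ xs) (walk-∷ _ _ _ e wk) = walk-∷ _ _ _ e (walk-prefix (y ∷ xs) wk)

  walk-glue : ∀ xs {x ys} → IsWalk G (xs ∷ʳ x) → IsWalk G (x ∷ ys) → IsWalk G (xs ++ x ∷ ys)
  walk-glue []           _                    wk = wk
  walk-glue (_ ∷ [])     (walk-∷ _ _ _ e _)  wk = walk-∷ _ _ _ e wk
  walk-glue (_ ∷ y ∷ xs) (walk-∷ _ _ _ e w₁) wk = walk-∷ _ _ _ e (walk-glue (y ∷ xs) w₁ wk)

  walk-ʳ++ : ∀ xs {x ys} → IsWalk G (x ∷ xs) → IsWalk G (x ∷ ys) → IsWalk G (xs ʳ++ x ∷ ys)
  walk-ʳ++ []       _                    wk = wk
  walk-ʳ++ (y ∷ xs) (walk-∷ _ _ _ e w₁) wk = walk-ʳ++ xs w₁ (walk-∷ _ _ _ (~-sym G e) wk)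

  walk-reverse : ∀ {xs} → IsWalk G xs → IsWalk G (reverse xs)
  walk-reverse {[]}     _  = walk-[]
  walk-reverse {_ ∷ xs} wk = walk-ʳ++ xs wk (walk-[x] _)

  N⊆prefix⇒last : ∀ xs {ys v} → Unique (xs ++ ys) → IsWalk G (xs ++ ys) →
                  N[ G ] v ⊆ xs → v ∈ ys → ys ≡ v ∷ []
  N⊆prefix⇒last xs {_ ∷ []}    _ _  _  (here refl) = refl
  N⊆prefix⇒last xs {_ ∷ _ ∷ _} u wk N⊆ (here refl) =
    ⊥-elim (unique-++-disjoint xs u (N⊆ (walk-edge xs wk)) (there (here refl)))
  N⊆prefix⇒last xs {y ∷ ys} u wk N⊆ (there v∈ys)
    with N⊆prefix⇒last (xs ∷ʳ y) (subst Unique (sym assoc) u) (subst (IsWalk G) (sym assoc) wk)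
           (∈-++⁺ˡ ∘ N⊆) v∈ys
    where assoc = ++-assoc xs [ y ] ys
  ... | refl = ⊥-elim (unique-++-disjoint xs u (N⊆ (~-sym G (walk-edge xs wk))) (here refl))

  N⊆suffix⇒first : ∀ xs {v ys} → Unique (xs ++ v ∷ ys) → IsWalk G (xs ++ v ∷ ys) →
                   N[ G ] v ⊆ ys → xs ≡ []
  N⊆suffix⇒first []       _            _  _  = refl
  N⊆suffix⇒first (x ∷ xs) (x∉xs ∷ u) wk N⊆ with N⊆suffix⇒first xs u (walk-∷⁻ wk) N⊆
  ... | refl = ⊥-elim (All.lookup x∉xs (there (N⊆ (~-sym G (walk-edge [] wk)))) refl)

  pathAvoiding-closed : ∀ {S x y} (C : Fin n → Set) →
                        (∀ {z z′} → C z → z ~[ G ] z′ → z′ ∉ S → C z′) →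
                        PathAvoiding G S x y → C x → C y
  pathAvoiding-closed {S} C closed p = go (verts p) (isWalk p) (ends p) (avoid p)
    where
    go : ∀ {x y} zs → IsWalk G (x ∷ zs) → last (x ∷ zs) ≡ just y → All (_∉ S) (x ∷ zs) → C x → C y
    go []       _                    refl _            Cx = Cx
    go (_ ∷ zs) (walk-∷ _ _ _ e wk) eq   (_ ∷ avoids) Cx =
      go zs wk eq avoids (closed Cx e (All.head avoids))

walk-map : ∀ {m} {G : Graph n} {H : Graph m} (f : Fin n → Fin m) →
           (∀ {x y} → x ~[ G ] y → f x ~[ H ] f y) → ∀ {xs} → IsWalk G xs → IsWalk H (map f xs)
walk-map f hom walk-[]              = walk-[]
walk-map f hom (walk-[x] x)         = walk-[x] (f x)
walk-map f hom (walk-∷ _ _ _ e wk) = walk-∷ _ _ _ (hom e) (walk-map f hom wk)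

ham-↭ : ∀ {G H : Graph n} {xs ys} → IsWalk G ys → ys ↭ xs → HamPath H xs → HamPath G ys
ham-↭ wk ys↭xs h = record
  { isWalk = wk
  ; unique = Unique-resp-↭ (↭⇒↭ₛ (↭-sym ys↭xs)) (unique h)
  ; covers = λ x → ∈-resp-↭ (↭-sym ys↭xs) (covers h x)
  }
  where open PermutationProperties (≡-setoid (Fin _)) using (Unique-resp-↭)

ham-reverse : ∀ {G : Graph n} {xs} → HamPath G xs → HamPath G (reverse xs)
ham-reverse {xs = xs} h = ham-↭ (walk-reverse (isWalk h)) (↭-reverse xs) h

-- Adding an edge

module _ (G : Graph n) {u w : Fin n} where

  addEdge-adj⁻ : ∀ {x y} → x ~[ addEdge G u w ] y →
                 x ~[ G ] y ⊎ (x ≡ u × y ≡ w) ⊎ (x ≡ w × y ≡ u)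
  addEdge-adj⁻ {x} {y} e with x ≟ y | adj G x y | x ≟ u | y ≟ w | x ≟ w | y ≟ u
  addEdge-adj⁻ () | yes _ | _     | _     | _     | _     | _
  ... | no _ | true  | _     | _     | _     | _     = inj₁ refl
  ... | no _ | false | yes p | yes q | _     | _     = inj₂ (inj₁ (p , q))
  ... | no _ | false | _     | _     | yes p | yes q = inj₂ (inj₂ (p , q))
  addEdge-adj⁻ () | no _ | false | no _  | _     | no _  | _
  addEdge-adj⁻ () | no _ | false | no _  | _     | yes _ | no _
  addEdge-adj⁻ () | no _ | false | yes _ | no _  | no _  | _
  addEdge-adj⁻ () | no _ | false | yes _ | no _  | yes _ | no _

  addEdge-adj⁺ : ∀ {x y} → x ~[ G ] y → x ~[ addEdge G u w ] y
  addEdge-adj⁺ {x} {y} x~y with x ≟ y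
  ... | yes x≡y = ⊥-elim (~-irrefl G x~y x≡y)
  ... | no  _   rewrite x~y = refl

  addEdge-new : u ≢ w → u ~[ addEdge G u w ] w
  addEdge-new u≢w with u ≟ w
  ... | yes u≡w = ⊥-elim (u≢w u≡w)
  ... | no  _   rewrite dec-true (u ≟ u) refl | dec-true (w ≟ w) refl = ∨-zeroʳ (adj G u w)

  N⊆-addEdge : ∀ {x S} → x ≢ u → x ≢ w → N[ G ] x ⊆ S → N[ addEdge G u w ] x ⊆ S
  N⊆-addEdge x≢u x≢w N⊆ x~z with addEdge-adj⁻ x~z
  ... | inj₁ x~z′             = N⊆ x~z′
  ... | inj₂ (inj₁ (x≡u , _)) = ⊥-elim (x≢u x≡u)
  ... | inj₂ (inj₂ (x≡w , _)) = ⊥-elim (x≢w x≡w)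

  N⊆-addEdge-endpoint : ∀ {S} → N[ G ] u ⊆ S → N[ addEdge G u w ] u ⊆ w ∷ S
  N⊆-addEdge-endpoint N⊆ u~z with addEdge-adj⁻ u~z
  ... | inj₁ u~z′                = there (N⊆ u~z′)
  ... | inj₂ (inj₁ (_ , z≡w))    = here z≡w
  ... | inj₂ (inj₂ (u≡w , z≡u)) = here (trans z≡u u≡w)

  walk-addEdge⁻ : ∀ {xs} → IsWalk (addEdge G u w) xs →
                  IsWalk G xs ⊎ Traverses xs u w ⊎ Traverses xs w u
  walk-addEdge⁻ walk-[]      = inj₁ walk-[]
  walk-addEdge⁻ (walk-[x] x) = inj₁ (walk-[x] x)
  walk-addEdge⁻ (walk-∷ x y ys e wk) with addEdge-adj⁻ e
  ... | inj₂ (inj₁ (refl , refl)) = inj₂ (inj₁ ([] , ys , refl))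
  ... | inj₂ (inj₂ (refl , refl)) = inj₂ (inj₂ ([] , ys , refl))
  ... | inj₁ x~y with walk-addEdge⁻ wk
  ...   | inj₁ wk′                      = inj₁ (walk-∷ x y ys x~y wk′)
  ...   | inj₂ (inj₁ (zs , zs′ , eq)) = inj₂ (inj₁ (x ∷ zs , zs′ , cong (x ∷_) eq))
  ...   | inj₂ (inj₂ (zs , zs′ , eq)) = inj₂ (inj₂ (x ∷ zs , zs′ , cong (x ∷_) eq))

  walk-addEdge-avoiding : ∀ {xs z} → z ∈ u ∷ w ∷ [] → z ∉ xs → IsWalk (addEdge G u w) xs → IsWalk G xs
  walk-addEdge-avoiding z∈uw z∉xs wk with walk-addEdge⁻ wk
  ... | inj₁ wk′                    = wk′
  ... | inj₂ (inj₁ (ys , _ , refl)) = ⊥-elim (z∉xs (∈-++⁺ʳ ys (∈-++⁺ˡ z∈uw)))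
  ... | inj₂ (inj₂ (ys , _ , refl)) = ⊥-elim (z∉xs (∈-++⁺ʳ ys (∈-++⁺ˡ (∈-swap z∈uw))))

neighbours : Graph n → Fin n → List (Fin n)
neighbours G v = filter (λ w → adj G v w Bool.≟ true) (allFin _)

∈-neighbours⁺ : ∀ (G : Graph n) {v w} → v ~[ G ] w → w ∈ neighbours G v
∈-neighbours⁺ G {v} {w} v~w = ∈-filter⁺ (λ w → adj G v w Bool.≟ true) (∈-allFin w) v~w

degree≤⇒N⊆ : ∀ (G : Graph n) {v S} → Unique S → (∀ {z} → z ∈ S → v ~[ G ] z) →
             degree G v ≤ length S → N[ G ] v ⊆ S
degree≤⇒N⊆ G S-unique S⊆N deg≤ v~z =
  ⊆∧length≤⇒⊇ _≟_ S-unique (∈-neighbours⁺ G ∘ S⊆N) deg≤ (∈-neighbours⁺ G v~z)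

N⊆⊎third-neighbour : ∀ (G : Graph n) x y z →
                     N[ G ] x ⊆ y ∷ z ∷ [] ⊎ ∃ λ c → x ~[ G ] c × c ≢ y × c ≢ z
N⊆⊎third-neighbour G x y z with any? (λ c → (adj G x c Bool.≟ true) ×-dec ¬? (c ≟ y) ×-dec ¬? (c ≟ z))
... | yes (c , x~c , c≢y , c≢z) = inj₂ (c , x~c , c≢y , c≢z)
... | no ∄c                      = inj₁ N⊆
  where
  N⊆ : N[ G ] x ⊆ y ∷ z ∷ []
  N⊆ {c} x~c with c ≟ y | c ≟ z
  ... | yes c≡y | _       = here c≡y
  ... | no  _   | yes c≡z = there (here c≡z)
  ... | no  c≢y | no  c≢z = ⊥-elim (∄c (c , x~c , c≢y , c≢z))

-- Twins

transpose-cases : ∀ (i j k : Fin n) →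
                  (k ≡ i × transpose i j k ≡ j) ⊎ (k ≡ j × transpose i j k ≡ i) ⊎
                  (k ≢ i × k ≢ j × transpose i j k ≡ k)
transpose-cases i j k with k ≟ i
... | yes k≡i = inj₁ (k≡i , refl)
... | no  k≢i with k ≟ j
...   | yes k≡j = inj₂ (inj₁ (k≡j , refl))
...   | no  k≢j = inj₂ (inj₂ (k≢i , k≢j , refl))

transpose-ʳ : ∀ (i j : Fin n) → transpose i j j ≡ i
transpose-ʳ i j with transpose-cases i j j
... | inj₁ (j≡i , τj≡j)         = trans τj≡j j≡i
... | inj₂ (inj₁ (_ , τj≡i))    = τj≡i
... | inj₂ (inj₂ (_ , j≢j , _)) = ⊥-elim (j≢j refl)

transpose-fixes : ∀ {i j k : Fin n} → k ≢ i → k ≢ j → transpose i j k ≡ k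
transpose-fixes {i = i} {j} {k} k≢i k≢j with transpose-cases i j k
... | inj₁ (k≡i , _)             = ⊥-elim (k≢i k≡i)
... | inj₂ (inj₁ (k≡j , _))      = ⊥-elim (k≢j k≡j)
... | inj₂ (inj₂ (_ , _ , τk≡k)) = τk≡k

Twins : Graph n → Fin n → Fin n → Set
Twins H x y = ∀ {z} → z ≢ x → z ≢ y → (x ~[ H ] z → y ~[ H ] z) × (y ~[ H ] z → x ~[ H ] z)

module _ {H : Graph n} {x y : Fin n} (twins : Twins H x y) where

  transpose-preserves-~ : ∀ {p q} → p ~[ H ] q → transpose x y p ~[ H ] transpose x y q
  transpose-preserves-~ {p} {q} p~q with transpose-cases x y p | transpose-cases x y q
  ... | inj₁ (refl , _)  | inj₁ (refl , _) = ⊥-elim (~-irrefl H p~q refl)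
  ... | inj₁ (refl , τp) | inj₂ (inj₁ (refl , τq)) rewrite τp | τq = ~-sym H p~q
  ... | inj₁ (refl , τp) | inj₂ (inj₂ (q≢x , q≢y , τq)) rewrite τp | τq = proj₁ (twins q≢x q≢y) p~q
  ... | inj₂ (inj₁ (refl , τp)) | inj₁ (refl , τq) rewrite τp | τq = ~-sym H p~q
  ... | inj₂ (inj₁ (refl , _))  | inj₂ (inj₁ (refl , _)) = ⊥-elim (~-irrefl H p~q refl)
  ... | inj₂ (inj₁ (refl , τp)) | inj₂ (inj₂ (q≢x , q≢y , τq)) rewrite τp | τq = proj₂ (twins q≢x q≢y) p~q
  ... | inj₂ (inj₂ (p≢x , p≢y , τp)) | inj₁ (refl , τq) rewrite τp | τq =
    ~-sym H (proj₁ (twins p≢x p≢y) (~-sym H p~q))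
  ... | inj₂ (inj₂ (p≢x , p≢y , τp)) | inj₂ (inj₁ (refl , τq)) rewrite τp | τq =
    ~-sym H (proj₂ (twins p≢x p≢y) (~-sym H p~q))
  ... | inj₂ (inj₂ (_ , _ , τp)) | inj₂ (inj₂ (_ , _ , τq)) rewrite τp | τq = p~q

  ham-transpose : ∀ {xs} → HamPath H xs → HamPath H (map (transpose x y) xs)
  ham-transpose h = record
    { isWalk = walk-map (transpose x y) transpose-preserves-~ (isWalk h)
    ; unique = map⁺ transpose-injective (unique h)
    ; covers = λ z → subst (_∈ _) (transpose-inverse x y)
                       (∈-map⁺ (transpose x y) (covers h (transpose y x z)))
    }
    where
    transpose-injective : ∀ {p q} → transpose x y p ≡ transpose x y q → p ≡ q
    transpose-injective τp≡τq =
      trans (sym (transpose-inverse y x)) (trans (cong (transpose y x) τp≡τq) (transpose-inverse y x))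

-- Vertices of degree two

ham-through-edge-end : ∀ {G H : Graph n} {v u w} → v ~[ G ] u → v ~[ G ] w → N[ H ] v ⊆ u ∷ w ∷ [] →
                       (∀ {zs} → w ∉ zs → IsWalk H zs → IsWalk G zs) →
                       ∀ xs {ys} → HamPath H (xs ++ u ∷ w ∷ ys) → v ∈ ys → Traceable G
ham-through-edge-end {G = G} {H} {v} {u} {w} v~u v~w N⊆ toG xs {ys} h v∈ys
  with N⊆prefix⇒last (xs ++ u ∷ w ∷ []) (subst Unique (sym assoc) (unique h))
         (subst (IsWalk H) (sym assoc) (isWalk h)) (∈-++⁺ʳ xs ∘ N⊆) v∈ys
  where assoc = ++-assoc xs (u ∷ w ∷ []) ys
... | refl = xs ++ u ∷ v ∷ w ∷ [] , ham-↭ walk (++⁺ˡ xs (prep u (swap v w ↭-refl))) h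
  where
  walk : IsWalk G (xs ++ u ∷ v ∷ w ∷ [])
  walk = walk-glue xs (toG (unique-∉-∷ʳ xs (unique h)) (walk-prefix xs (isWalk h)))
           (walk-∷ u v _ (~-sym G v~u) (walk-∷ v w [] v~w (walk-[x] w)))

ham-through-edge : ∀ {G H : Graph n} {v u w} → v ~[ G ] u → v ~[ G ] w → N[ H ] v ⊆ u ∷ w ∷ [] →
                   (∀ {z zs} → z ∈ u ∷ w ∷ [] → z ∉ zs → IsWalk H zs → IsWalk G zs) →
                   ∀ xs {ys} → HamPath H (xs ++ u ∷ w ∷ ys) → Traceable G
ham-through-edge {G = G} {v = v} {u} {w} v~u v~w N⊆ toG xs {ys} h with ∈-++⁻ xs (covers h v)
... | inj₂ (here v≡u)           = ⊥-elim (~-irrefl G v~u v≡u)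
... | inj₂ (there (here v≡w))   = ⊥-elim (~-irrefl G v~w v≡w)
... | inj₂ (there (there v∈ys)) = ham-through-edge-end v~u v~w N⊆ (toG (there (here refl))) xs h v∈ys
... | inj₁ v∈xs                 =
  ham-through-edge-end v~w v~u (∈-swap ∘ N⊆) (toG (here refl)) (reverse ys)
    (subst (HamPath _) (reverse-middle xs u w ys) (ham-reverse h)) (∈-resp-↭ (↭-sym (↭-reverse xs)) v∈xs)

module _ {G : Graph n} {v a b : Fin n} (v~a : v ~[ G ] a) (v~b : v ~[ G ] b)
  (N⊆ : N[ G ] v ⊆ a ∷ b ∷ []) where

  private
    NH⊆ : N[ addEdge G a b ] v ⊆ a ∷ b ∷ []
    NH⊆ = N⊆-addEdge G (~-irrefl G v~a) (~-irrefl G v~b) N⊆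

    toG : ∀ {z zs} → z ∈ a ∷ b ∷ [] → z ∉ zs → IsWalk (addEdge G a b) zs → IsWalk G zs
    toG = walk-addEdge-avoiding G

  addEdge-traceable⇒traceable : Traceable (addEdge G a b) → Traceable G
  addEdge-traceable⇒traceable (P , h) with walk-addEdge⁻ G (isWalk h)
  ... | inj₁ wk                     = P , ham-↭ wk ↭-refl h
  ... | inj₂ (inj₁ (xs , _ , refl)) = ham-through-edge v~a v~b NH⊆ toG xs h
  ... | inj₂ (inj₂ (xs , _ , refl)) = ham-through-edge v~b v~a (∈-swap ∘ NH⊆) (toG ∘ ∈-swap) xs h

neighbours-adjacent : ∀ {G : Graph n} {v a b} → MaximalNontraceable G → N[ G ] v ⊆ a ∷ b ∷ [] →
                      a ≢ b → v ~[ G ] a → v ~[ G ] b → a ~[ G ] b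
neighbours-adjacent {G = G} {a = a} {b} (¬traceable , maximal) N⊆ a≢b v~a v~b with adj G a b in a~b
... | true  = refl
... | false = ⊥-elim (¬traceable (addEdge-traceable⇒traceable v~a v~b N⊆ (maximal a b a≢b a~b)))

closed-pair⇒three-vertices : ∀ {G : Graph n} {v a b} → TwoConnected G → v ≢ b →
                             N[ G ] v ⊆ a ∷ b ∷ [] → N[ G ] a ⊆ v ∷ b ∷ [] →
                             ∀ x → x ∈ v ∷ a ∷ b ∷ []
closed-pair⇒three-vertices {G = G} {v} {a} {b} (_ , _ , 2-connected) v≢b Nv⊆ Na⊆ x =
  decidable-stable (x ∈? v ∷ a ∷ b ∷ []) λ x∉ →
    x∉ (∈-++⁺ˡ (pathAvoiding-closed (_∈ v ∷ a ∷ []) closed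
                  (2-connected b v x v≢b (x∉ ∘ there ∘ there ∘ here)) (here refl)))
  where
  open DecMembership _≟_ using (_∈?_)
  closed : ∀ {z z′} → z ∈ v ∷ a ∷ [] → z ~[ G ] z′ → z′ ∉ b ∷ [] → z′ ∈ v ∷ a ∷ []
  closed (here refl) v~z′ z′∉b with Nv⊆ v~z′
  ... | here z′≡a         = there (here z′≡a)
  ... | there (here z′≡b) = ⊥-elim (z′∉b (here z′≡b))
  closed (there (here refl)) a~z′ z′∉b with Na⊆ a~z′
  ... | here z′≡v         = here z′≡v
  ... | there (here z′≡b) = ⊥-elim (z′∉b (here z′≡b))

module _ {G : Graph n} {v a b c : Fin n}
  (v~a : v ~[ G ] a) (v~b : v ~[ G ] b) (a~b : a ~[ G ] b) (a~c : a ~[ G ] c)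
  (c≢v : c ≢ v) (c≢b : c ≢ b)
  (Nv⊆ : N[ G ] v ⊆ a ∷ b ∷ []) (Na⊆ : N[ G ] a ⊆ v ∷ b ∷ c ∷ []) where

  private
    H = addEdge G v c

    a≢v : a ≢ v
    a≢v a≡v = ~-irrefl G v~a (sym a≡v)

    a≢c : a ≢ c
    a≢c = ~-irrefl G a~c

    NvH⊆ : N[ H ] v ⊆ c ∷ a ∷ b ∷ []
    NvH⊆ = N⊆-addEdge-endpoint G Nv⊆

    NaH⊆ : N[ H ] a ⊆ v ∷ b ∷ c ∷ []
    NaH⊆ = N⊆-addEdge G a≢v a≢c Na⊆

    toG : ∀ {z zs} → z ∈ v ∷ c ∷ [] → z ∉ zs → IsWalk H zs → IsWalk G zs
    toG = walk-addEdge-avoiding G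

    twins : Twins H v a
    twins {z} z≢v z≢a = v→a , a→v
      where
      v→a : v ~[ H ] z → a ~[ H ] z
      v→a v~z with NvH⊆ v~z
      ... | here refl                 = addEdge-adj⁺ G a~c
      ... | there (here z≡a)          = ⊥-elim (z≢a z≡a)
      ... | there (there (here refl)) = addEdge-adj⁺ G a~b
      a→v : a ~[ H ] z → v ~[ H ] z
      a→v a~z with NaH⊆ a~z
      ... | here z≡v                  = ⊥-elim (z≢v z≡v)
      ... | there (here refl)         = addEdge-adj⁺ G v~b
      ... | there (there (here refl)) = addEdge-new G (c≢v ∘ sym)

    v-first : ∀ {ys} → HamPath H (v ∷ c ∷ a ∷ ys) → b ∈ ys → Traceable G
    v-first {[]}     _ ()
    v-first {y ∷ ys} h _ with NaH⊆ (walk-edge (v ∷ c ∷ []) (isWalk h))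
    ... | here refl                 =
      ⊥-elim (unique-++-disjoint (v ∷ c ∷ a ∷ []) (unique h) (here refl) (here refl))
    ... | there (there (here refl)) =
      ⊥-elim (unique-++-disjoint (v ∷ c ∷ a ∷ []) (unique h) (there (here refl)) (here refl))
    ... | there (here refl)         = c ∷ a ∷ v ∷ b ∷ ys , ham-↭ walk (shift v (c ∷ a ∷ []) (b ∷ ys)) h
      where
      walk : IsWalk G (c ∷ a ∷ v ∷ b ∷ ys)
      walk = walk-∷ c a _ (~-sym G a~c) (walk-∷ a v _ (~-sym G v~a) (walk-∷ v b ys v~b
               (toG (here refl) (unique-++-disjoint (v ∷ c ∷ a ∷ []) (unique h) (here refl))
                  (walk-++⁻ʳ (v ∷ c ∷ a ∷ []) (isWalk h)))))

    b-after : ∀ xs {ys} → HamPath H (xs ++ v ∷ c ∷ a ∷ ys) → b ∈ ys → Traceable G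
    b-after xs {ys} h b∈ys with N⊆suffix⇒first xs (unique h) (isWalk h) Nv⊆after
      where
      Nv⊆after : N[ H ] v ⊆ c ∷ a ∷ ys
      Nv⊆after v~z with NvH⊆ v~z
      ... | here refl                 = here refl
      ... | there (here refl)         = there (here refl)
      ... | there (there (here refl)) = there (there b∈ys)
    ... | refl = v-first h b∈ys

    b-before : ∀ xs {ys} → HamPath H (xs ++ v ∷ c ∷ a ∷ ys) → b ∈ xs → Traceable G
    b-before xs {ys} h b∈xs
      with N⊆prefix⇒last (xs ++ v ∷ c ∷ []) (subst Unique (sym assoc) (unique h))
             (subst (IsWalk H) (sym assoc) (isWalk h)) Na⊆before (here refl)
      where
      assoc = ++-assoc xs (v ∷ c ∷ []) (a ∷ ys)
      Na⊆before : N[ H ] a ⊆ xs ++ v ∷ c ∷ []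
      Na⊆before a~z with NaH⊆ a~z
      ... | here refl                 = ∈-++⁺ʳ xs (here refl)
      ... | there (here refl)         = ∈-++⁺ˡ b∈xs
      ... | there (there (here refl)) = ∈-++⁺ʳ xs (there (here refl))
    ... | refl = xs ++ v ∷ a ∷ c ∷ [] , ham-↭ walk (++⁺ˡ xs (prep v (swap a c ↭-refl))) h
      where
      walk : IsWalk G (xs ++ v ∷ a ∷ c ∷ [])
      walk = walk-glue xs (toG (there (here refl)) (unique-∉-∷ʳ xs (unique h)) (walk-prefix xs (isWalk h)))
               (walk-∷ v a _ v~a (walk-∷ a c [] a~c (walk-[x] c)))

    ham-through-vca : ∀ xs {ys} → HamPath H (xs ++ v ∷ c ∷ a ∷ ys) → Traceable G
    ham-through-vca xs h with ∈-++⁻ xs (covers h b)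
    ... | inj₁ b∈xs                         = b-before xs h b∈xs
    ... | inj₂ (here b≡v)                   = ⊥-elim (~-irrefl G v~b (sym b≡v))
    ... | inj₂ (there (here b≡c))           = ⊥-elim (c≢b (sym b≡c))
    ... | inj₂ (there (there (here b≡a)))   = ⊥-elim (~-irrefl G a~b (sym b≡a))
    ... | inj₂ (there (there (there b∈ys))) = b-after xs h b∈ys

    untranspose-vc : ∀ {P} →
                     Traverses (map (transpose v a) P) v c ⊎ Traverses (map (transpose v a) P) c v →
                     Traverses P a c ⊎ Traverses P c a
    untranspose-vc = Sum.map (subst₂ (Traverses _) τv≡a τc≡c ∘ untranspose)
                             (subst₂ (Traverses _) τc≡c τv≡a ∘ untranspose)
      where
      untranspose : ∀ {P p q} → Traverses (map (transpose v a) P) p q →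
                    Traverses P (transpose a v p) (transpose a v q)
      untranspose = traverses-map⁻ (λ _ → transpose-inverse a v)
      τv≡a : transpose a v v ≡ a
      τv≡a = transpose-ʳ a v
      τc≡c : transpose a v c ≡ c
      τc≡c = transpose-fixes (a≢c ∘ sym) c≢v

    ham-through-vc : ∀ {P} → HamPath H P → Traverses P v c → Traceable G
    ham-through-vc h (xs , ys , refl) with walk-addEdge⁻ G (isWalk (ham-transpose twins h))
    ... | inj₁ wk = _ , ham-↭ wk ↭-refl (ham-transpose twins h)
    ... | inj₂ t with traverses-next xs (unique h) (a≢v ∘ sym) (untranspose-vc t)
    ...   | _ , refl = ham-through-vca xs h

  addEdge-twins-traceable⇒traceable : Traceable (addEdge G v c) → Traceable G
  addEdge-twins-traceable⇒traceable (P , h) with walk-addEdge⁻ G (isWalk h)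
  ... | inj₁ wk          = P , ham-↭ wk ↭-refl h
  ... | inj₂ (inj₁ v→c) = ham-through-vc h v→c
  ... | inj₂ (inj₂ c→v) = ham-through-vc (ham-reverse h) (traverses-reverse c→v)

neighbour-degree≥4 : ∀ {G : Graph n} {v a b} → MaximalNontraceable G → TwoConnected G →
                     N[ G ] v ⊆ a ∷ b ∷ [] → v ~[ G ] a → v ~[ G ] b → a ~[ G ] b → degree G a ≥ 4
neighbour-degree≥4 {G = G} {v} {a} {b} (¬traceable , maximal) 2-connected Nv⊆ v~a v~b a~b
  with 4 ≤? degree G a | N⊆⊎third-neighbour G a v b
... | yes 4≤deg | _        = 4≤deg
... | no _      | inj₁ Na⊆ = ⊥-elim (¬traceable (v ∷ a ∷ b ∷ [] , record
  { isWalk = walk-∷ v a _ v~a (walk-∷ a b [] a~b (walk-[x] b))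
  ; unique = (~-irrefl G v~a ∷ ~-irrefl G v~b ∷ []) ∷ (~-irrefl G a~b ∷ []) ∷ [] ∷ []
  ; covers = closed-pair⇒three-vertices 2-connected (~-irrefl G v~b) Nv⊆ Na⊆
  }))
... | no deg≱4  | inj₂ (c , a~c , c≢v , c≢b) =
  ⊥-elim (¬traceable (addEdge-twins-traceable⇒traceable v~a v~b a~b a~c c≢v c≢b Nv⊆ Na⊆
                        (maximal v c (c≢v ∘ sym) v≁c)))
  where
  Na⊆ : N[ G ] a ⊆ v ∷ b ∷ c ∷ []
  Na⊆ = degree≤⇒N⊆ G ((~-irrefl G v~b ∷ (c≢v ∘ sym) ∷ []) ∷ ((c≢b ∘ sym) ∷ []) ∷ [] ∷ [])
          (λ { (here refl) → ~-sym G v~a ; (there (here refl)) → a~b ; (there (there (here refl))) → a~c })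
          (≤-pred (≰⇒> deg≱4))
  v≁c : adj G v c ≡ false
  v≁c = ¬-not λ v~c → case Nv⊆ v~c of λ
    { (here c≡a)         → ~-irrefl G a~c (sym c≡a)
    ; (there (here c≡b)) → c≢b c≡b
    }

lemma2 : ∀ {n} (G : Graph n) → MaximalNontraceable G →
    ∀ (v a b : Fin n) → degree G v ≡ 2 → a ≢ b → v ~[ G ] a → v ~[ G ] b →
    (a ~[ G ] b) × (TwoConnected G → (degree G a ≥ 4) × (degree G b ≥ 4))
lemma2 G mnt v a b deg≡2 a≢b v~a v~b =
  a~b , λ 2-connected → neighbour-degree≥4 mnt 2-connected Nv⊆ v~a v~b a~b
                      , neighbour-degree≥4 mnt 2-connected (∈-swap ∘ Nv⊆) v~b v~a (~-sym G a~b)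
  where
  Nv⊆ : N[ G ] v ⊆ a ∷ b ∷ []
  Nv⊆ = degree≤⇒N⊆ G ((a≢b ∷ []) ∷ [] ∷ []) (λ { (here refl) → v~a ; (there (here refl)) → v~b })
          (≤-reflexive deg≡2)
  a~b : a ~[ G ] b
  a~b = neighbours-adjacent mnt Nv⊆ a≢b v~a v~b
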